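{- For $1\leq n<\omega$, the structure $\mathcal{B}_n=(\Sigma^*,\leq,*)$ (the $(\leq,*)$-reduct of $\mathcal{A}_n$) is not $(\subseteq,*)$-representable: there is no set $X$ and injective map $\theta:\Sigma^*\to\mathrm{Rel}(X)$ with $\theta(\alpha*\beta)=\theta(\alpha)*\theta(\beta)$ (demonic composition on the right) and $\alpha\leq\beta\iff\theta(\alpha)\subseteq\theta(\beta)$.
   Context: Demonic composition of binary relations: $s*t=\{(x,y):\exists z((x,z)\in s\wedge(z,y)\in t)\wedge\forall w((x,w)\in s\to\exists v\,(w,v)\in t)\}$. Fix $n$. Let $\Sigma=\{t,s_0,\dots,s_n\}$ be an alphabet of $n+2$ letters, $\Sigma^*$ the set of finite words over $\Sigma$ including the empty word $\Lambda$. Let $L=\{(s_0,s_n)\}\cup\{(s_i,s_{i+1}t):i<n\}$ (pairs of words), $<\;=\{(\alpha\sigma,\alpha\sigma^+):\alpha\in\Sigma^*,(\sigma,\sigma^+)\in L\}$, and $\leq\;=\;<\cup\{(\alpha,\alpha):\alpha\in\Sigma^*\}$. Let $*$ on $\Sigma^*$ be concatenation and $\mathcal{A}_n=(\Sigma^*,\leq,*,\Lambda)$. -}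

module Defs where

open import Data.Nat using (ℕ; suc)
open import Data.Fin using (Fin; zero; suc; fromℕ; inject₁)
open import Data.List using (List; []; _∷_; _++_)
open import Data.Product using (Σ; ∃; _×_; _,_)
open import Data.Sum using (_⊎_)
open import Relation.Binary.PropositionalEquality using (_≡_)

data Letter (n : ℕ) : Set where
  t : Letter n
  s : Fin (suc n) → Letter n

-- Σ* : finite words, Λ = [] ; * on words is concatenation _++_.
Word : ℕ → Set
Word n = List (Letter n)

data L (n : ℕ) : Word n → Word n → Set where
  L-base : L n (s zero ∷ []) (s (fromℕ n) ∷ [])
  L-step : (i : Fin n) → L n (s (inject₁ i) ∷ []) (s (suc i) ∷ t ∷ [])

_<w_ : {n : ℕ} → Word n → Word n → Set
_<w_ {n} α β = Σ (Word n) λ α' → Σ (Word n) λ σ → Σ (Word n) λ σ⁺ →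
  L n σ σ⁺ × (α ≡ α' ++ σ) × (β ≡ α' ++ σ⁺)

_≤w_ : {n : ℕ} → Word n → Word n → Set
α ≤w β = (α <w β) ⊎ (α ≡ β)

Rel : Set → Set₁
Rel X = X → X → Set

_⊆R_ : {X : Set} → Rel X → Rel X → Set
r ⊆R r' = ∀ x y → r x y → r' x y

_≐R_ : {X : Set} → Rel X → Rel X → Set
r ≐R r' = (r ⊆R r') × (r' ⊆R r)

_⊙_ : {X : Set} → Rel X → Rel X → Rel X
_⊙_ {X} r r' x y = (Σ X λ z → r x z × r' z y) × (∀ w → r x w → Σ X λ v → r' w v)

IsRepresentation : (n : ℕ) (X : Set) → (Word n → Rel X) → Set
IsRepresentation n X θ =
    (∀ α β → θ α ≐R θ β → α ≡ β)
  × (∀ α β → θ (α ++ β) ≐R (θ α ⊙ θ β))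
  × (∀ α β → (α ≤w β → θ α ⊆R θ β) × (θ α ⊆R θ β → α ≤w β))

-- In any representation, s₀t ⊆ sₙt. Every sᵢ lies below s_{i+1}t, so by induction on i a point
-- in the domain of θ(s₀) is in the domain of θ(sᵢ) for all i, and in particular of
-- θ(s_{n-1}) ⊆ θ(sₙ) ⊙ θ(t): all its θ(sₙ)-successors have θ(t)-successors. That is the
-- totality clause which, together with s₀ ≤ sₙ, lifts θ(s₀) ⊙ θ(t) into θ(sₙ) ⊙ θ(t).
-- But s₀t ≰ sₙt in 𝒜ₙ, since no word ending in t is strictly below anything.
module Submission where

open import Defs
open import Data.Nat using (ℕ; _≤_; suc; s≤s)
open import Data.Fin using (Fin; zero; suc; fromℕ; inject₁)
open import Data.Fin.Induction using (<-weakInduction)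
open import Data.List using ([]; _∷_; _++_; _∷ʳ_)
open import Data.List.Properties using (∷ʳ-injectiveʳ)
open import Data.Product using (Σ; _,_; proj₁; proj₂)
open import Data.Sum using (inj₁; inj₂)
open import Relation.Nullary using (¬_)
open import Relation.Binary.PropositionalEquality using (refl)

Dom : {X : Set} → Rel X → X → Set
Dom {X} r x = Σ X λ y → r x y

⊙-dom : {X : Set} {r r′ : Rel X} {x y : X} → (r ⊙ r′) x y → Dom r x
⊙-dom ((z , rxz , _) , _) = z , rxz

⊙-monoˡ-at : {X : Set} {r₁ r₂ r′ : Rel X} {x y : X} →
  r₁ ⊆R r₂ → Dom (r₂ ⊙ r′) x → (r₁ ⊙ r′) x y → (r₂ ⊙ r′) x y
⊙-monoˡ-at {x = x} r₁⊆r₂ (_ , (_ , total)) ((z , rxz , r′zy) , _) =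
  (z , r₁⊆r₂ x z rxz , r′zy) , total

∷ʳt-≮w : {n : ℕ} (α β : Word n) → ¬ ((α ∷ʳ t) <w β)
∷ʳt-≮w α _ (α′ , _ , _ , L-base   , e , _) with () ← ∷ʳ-injectiveʳ α α′ e
∷ʳt-≮w α _ (α′ , _ , _ , L-step _ , e , _) with () ← ∷ʳ-injectiveʳ α α′ e

s₀t≰sₙt : (m : ℕ) → ¬ ((s zero ∷ t ∷ []) ≤w (s (fromℕ (suc m)) ∷ t ∷ []))
s₀t≰sₙt _ (inj₁ s₀t<w) = ∷ʳt-≮w (s zero ∷ []) _ s₀t<w
s₀t≰sₙt _ (inj₂ ())

module Representation {n : ℕ} {X : Set} {θ : Word n → Rel X}
                      (rep : IsRepresentation n X θ) where

  θ-split : ∀ α β → θ (α ++ β) ⊆R (θ α ⊙ θ β)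
  θ-split α β = proj₁ (proj₁ (proj₂ rep) α β)

  θ-join : ∀ α β → (θ α ⊙ θ β) ⊆R θ (α ++ β)
  θ-join α β = proj₂ (proj₁ (proj₂ rep) α β)

  θ-mono : ∀ {α β} → α ≤w β → θ α ⊆R θ β
  θ-mono {α} {β} = proj₁ (proj₂ (proj₂ rep) α β)

  θ-reflects : ∀ {α β} → θ α ⊆R θ β → α ≤w β
  θ-reflects {α} {β} = proj₂ (proj₂ (proj₂ rep) α β)

  θ-L : ∀ {σ σ⁺} → L n σ σ⁺ → θ σ ⊆R θ σ⁺
  θ-L l = θ-mono (inj₁ ([] , _ , _ , l , refl , refl))

  dom-step : ∀ {x} (i : Fin n) →
    Dom (θ (s (inject₁ i) ∷ [])) x → Dom (θ (s (suc i) ∷ []) ⊙ θ (t ∷ [])) x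
  dom-step {x} i (z , rxz) =
    z , θ-split (s (suc i) ∷ []) (t ∷ []) x z (θ-L (L-step i) x z rxz)

  dom-chain : ∀ {x} → Dom (θ (s zero ∷ [])) x → (k : Fin (suc n)) → Dom (θ (s k ∷ [])) x
  dom-chain {x} d₀ = <-weakInduction (λ k → Dom (θ (s k ∷ [])) x) d₀
    (λ i dᵢ → ⊙-dom {r = θ (s (suc i) ∷ [])} (proj₂ (dom-step i dᵢ)))

mainTheorem13 : (n : ℕ) → 1 ≤ n →
    ¬ (Σ Set λ X → Σ (Word n → Rel X) λ θ → IsRepresentation n X θ)
mainTheorem13 (suc m) (s≤s _) (X , θ , rep) = s₀t≰sₙt m (θ-reflects s₀t⊆sₙt)
  where
  open Representation rep

  s₀t⊆sₙt : θ (s zero ∷ t ∷ []) ⊆R θ (s (fromℕ (suc m)) ∷ t ∷ [])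
  s₀t⊆sₙt x y θs₀t = θ-join (s (fromℕ (suc m)) ∷ []) (t ∷ []) x y
    (⊙-monoˡ-at (θ-L L-base) sₙ⊙t-total s₀⊙t)
    where
    s₀⊙t : (θ (s zero ∷ []) ⊙ θ (t ∷ [])) x y
    s₀⊙t = θ-split (s zero ∷ []) (t ∷ []) x y θs₀t

    sₙ₋₁-dom : Dom (θ (s (inject₁ (fromℕ m)) ∷ [])) x
    sₙ₋₁-dom = dom-chain (⊙-dom {r = θ (s zero ∷ [])} s₀⊙t) (inject₁ (fromℕ m))

    sₙ⊙t-total : Dom (θ (s (fromℕ (suc m)) ∷ []) ⊙ θ (t ∷ [])) x
    sₙ⊙t-total = dom-step (fromℕ m) sₙ₋₁-dom
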